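{- Let $G$ be a strongly regular graph with parameters $(n,k,1,2)$. Let $v_1v_0v_2$ be an induced path on three vertices in $G$ (so $v_0$ is adjacent to both $v_1$ and $v_2$, and $v_1,v_2$ are non-adjacent). Then the number of pentagons in $G$ that contain $v_1,v_0,v_2$ as three consecutive vertices is exactly $2(k-4)$.
   Context: A graph $G$ is strongly regular with parameters $(n,k,1,2)$ if it has $n$ vertices, is $k$-regular, every pair of adjacent vertices has exactly $1$ common neighbor, and every pair of distinct non-adjacent vertices has exactly $2$ common neighbors. A pentagon in $G$ is an induced subgraph of $G$ isomorphic to the cycle $C_5$ on five vertices. -}

module Defs where

open import Data.Bool using (Bool; T)
open import Data.Bool.Properties using (T?)
open import Data.Nat using (ℕ)
open import Data.Fin using (Fin; _≟_)
open import Data.List using (List; length; filter; allFin; cartesianProduct)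
open import Data.Product using (_×_; _,_; proj₁; proj₂)
open import Relation.Nullary using (¬_; Dec)
open import Relation.Nullary.Decidable using (_×-dec_; ¬?)
open import Relation.Binary.PropositionalEquality using (_≡_)

record Graph (n : ℕ) : Set where
  field
    adj   : Fin n → Fin n → Bool
    sym   : ∀ u v → adj u v ≡ adj v u
    irrefl : ∀ v → adj v v ≡ Data.Bool.false

open Graph public

Adjacent : ∀ {n} → Graph n → Fin n → Fin n → Set
Adjacent G u v = T (adj G u v)

adjacent? : ∀ {n} (G : Graph n) (u v : Fin n) → Dec (Adjacent G u v)
adjacent? G u v = T? (adj G u v)

degree : ∀ {n} → Graph n → Fin n → ℕ
degree {n} G v = length (filter (adjacent? G v) (allFin n))

commonNeighbours : ∀ {n} → Graph n → Fin n → Fin n → ℕ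
commonNeighbours {n} G u v =
  length (filter (λ w → adjacent? G u w ×-dec adjacent? G v w) (allFin n))

IsSRG : ∀ {n} → Graph n → (k λ' μ : ℕ) → Set
IsSRG {n} G k λ' μ =
  (∀ v → degree G v ≡ k) ×
  (∀ u v → Adjacent G u v → commonNeighbours G u v ≡ λ') ×
  (∀ u v → ¬ (u ≡ v) → ¬ Adjacent G u v → commonNeighbours G u v ≡ μ)

InducedPentagon : ∀ {n} → Graph n → Fin n → Fin n → Fin n → Fin n → Fin n → Set
InducedPentagon G a b c d e =
  (¬ a ≡ b × ¬ a ≡ c × ¬ a ≡ d × ¬ a ≡ e × ¬ b ≡ c × ¬ b ≡ d × ¬ b ≡ e ×
   ¬ c ≡ d × ¬ c ≡ e × ¬ d ≡ e) ×
  (Adjacent G a b × Adjacent G b c × Adjacent G c d × Adjacent G d e × Adjacent G e a) ×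
  (¬ Adjacent G a c × ¬ Adjacent G a d × ¬ Adjacent G b d × ¬ Adjacent G b e ×
   ¬ Adjacent G c e)

inducedPentagon? : ∀ {n} (G : Graph n) a b c d e → Dec (InducedPentagon G a b c d e)
inducedPentagon? G a b c d e =
  ((¬? (a ≟ b)) ×-dec (¬? (a ≟ c)) ×-dec (¬? (a ≟ d)) ×-dec (¬? (a ≟ e)) ×-dec
   (¬? (b ≟ c)) ×-dec (¬? (b ≟ d)) ×-dec (¬? (b ≟ e)) ×-dec
   (¬? (c ≟ d)) ×-dec (¬? (c ≟ e)) ×-dec (¬? (d ≟ e))) ×-dec
  (adjacent? G a b ×-dec adjacent? G b c ×-dec adjacent? G c d ×-dec
   adjacent? G d e ×-dec adjacent? G e a) ×-dec
  (¬? (adjacent? G a c) ×-dec ¬? (adjacent? G a d) ×-dec ¬? (adjacent? G b d) ×-dec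
   ¬? (adjacent? G b e) ×-dec ¬? (adjacent? G c e))

-- Such a pentagon has the form v₁ v₀ v₂ x y (cyclically), and the pair (x , y)
-- is uniquely determined by the pentagon (x is the pentagon-neighbour of v₂
-- other than v₀, y that of v₁), so we count these ordered pairs.
pentagonsThrough : ∀ {n} → Graph n → Fin n → Fin n → Fin n → ℕ
pentagonsThrough {n} G v₁ v₀ v₂ =
  length (filter (λ p → inducedPentagon? G v₁ v₀ v₂ (proj₁ p) (proj₂ p))
                 (cartesianProduct (allFin n) (allFin n)))

-- Call x an extension if v₁ v₀ v₂ x is an induced path, i.e. x ~ v₂ and x ≁ v₀, v₁. The
-- neighbourhood of v₂ consists of the extensions, the single common neighbour of v₀ and v₂,
-- and the two common neighbours v₀, w of v₁ and v₂, so there are k − 3 extensions. In a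
-- pentagon v₁ v₀ v₂ x y the vertex x is an extension, and for an extension x the admissible y
-- are the two common neighbours of v₁ and x other than a (the common neighbour of v₀ and v₁)
-- and w. Exactly one extension is adjacent to a (the common neighbour of a and v₂ besides v₀)
-- and exactly one is adjacent to w (the common neighbour of w and v₂), which gives
-- 2 (k − 3) − 2 pentagons.

module Submission where

open import Defs hiding (sym)
open import Data.Bool using (T; true; false; if_then_else_)
open import Data.Fin using (Fin; zero; suc; _≟_)
open import Data.Fin.Properties using (any?)
open import Data.List
  using (List; []; _∷_; _++_; length; filter; map; tabulate; allFin; cartesianProduct)
open import Data.List.Properties using (filter-++; length-++)
open import Data.Nat using (ℕ; zero; suc; _+_)
open import Data.Nat.Properties using (+-0-commutativeMonoid; suc-injective; 0≢1+n)
open import Data.Product using (∃; ∃!; _×_; _,_; proj₁; proj₂)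
open import Data.Sum using (_⊎_; inj₁; inj₂; [_,_])
open import Function using (_∘_; mk⇔)
open import Level using (Level)
open import Relation.Binary.PropositionalEquality
  using (_≡_; _≢_; refl; sym; trans; cong; cong₂; subst; module ≡-Reasoning)
open import Relation.Nullary using (¬_; Dec; yes; no; does; contradiction)
open import Relation.Nullary.Decidable using (_×-dec_; _⊎-dec_; ¬?; does-⇔; dec-false)
open import Relation.Unary using (Pred; Decidable; ｛_｝; ∁; _∩_; _∪_; _≐′_; _⊥′_)
open import Relation.Unary.Properties using (_∩?_; _∪?_; ∁?)
open import Algebra.Properties.CommutativeMonoid.Sum +-0-commutativeMonoid
  using (sum-syntax; sum-cong-≗; ∑-distrib-+; sum-replicate-zero)

private
  variable
    a b p q r : Level
    A B : Set a
    n : ℕ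

indicator : {P : Set p} → Dec P → ℕ
indicator P? = if does P? then 1 else 0

indicator-⇔ : {P : Set p} {Q : Set q} → (P → Q) → (Q → P) →
              (P? : Dec P) (Q? : Dec Q) → indicator P? ≡ indicator Q?
indicator-⇔ P→Q Q→P P? Q? = cong (if_then 1 else 0) (does-⇔ (mk⇔ P→Q Q→P) P? Q?)

indicator-⊎ : {P : Set p} {Q : Set q} → ¬ (P × Q) →
              (P? : Dec P) (Q? : Dec Q) → indicator (P? ⊎-dec Q?) ≡ indicator P? + indicator Q?
indicator-⊎ P∩Q=∅ (yes P) (yes Q) = contradiction (P , Q) P∩Q=∅
indicator-⊎ _     (yes _) (no _)  = refl
indicator-⊎ _     (no _)  (yes _) = refl
indicator-⊎ _     (no _)  (no _)  = refl

indicator-no : {P : Set p} → ¬ P → (P? : Dec P) → indicator P? ≡ 0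
indicator-no ¬P P? = cong (if_then 1 else 0) (dec-false P? ¬P)

length-filter-map : {P : Pred B p} (P? : Decidable P) (f : A → B) (xs : List A) →
                    length (filter P? (map f xs)) ≡ length (filter (P? ∘ f) xs)
length-filter-map P? f []       = refl
length-filter-map P? f (x ∷ xs) with does (P? (f x))
... | true  = cong suc (length-filter-map P? f xs)
... | false = length-filter-map P? f xs

length-filter-tabulate : {P : Pred A p} (P? : Decidable P) (f : Fin n → A) →
                         length (filter P? (tabulate f)) ≡ ∑[ i < n ] indicator (P? (f i))
length-filter-tabulate {n = zero}  P? f = refl
length-filter-tabulate {n = suc n} P? f with does (P? (f zero))
... | true  = cong suc (length-filter-tabulate P? (f ∘ suc))
... | false = length-filter-tabulate P? (f ∘ suc)

length-filter-cartesianProduct :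
  {P : Pred (A × B) p} (P? : Decidable P) (f : Fin n → A) (ys : List B) →
  length (filter P? (cartesianProduct (tabulate f) ys)) ≡
  ∑[ i < n ] length (filter (λ y → P? (f i , y)) ys)
length-filter-cartesianProduct {n = zero}  P? f ys = refl
length-filter-cartesianProduct {n = suc n} P? f ys = begin
  length (filter P? (map (f zero ,_) ys ++ cartesianProduct (tabulate (f ∘ suc)) ys))
    ≡⟨ cong length (filter-++ P? (map (f zero ,_) ys) _) ⟩
  length (filter P? (map (f zero ,_) ys) ++ filter P? (cartesianProduct (tabulate (f ∘ suc)) ys))
    ≡⟨ length-++ (filter P? (map (f zero ,_) ys)) ⟩
  length (filter P? (map (f zero ,_) ys)) + length (filter P? (cartesianProduct (tabulate (f ∘ suc)) ys))
    ≡⟨ cong₂ _+_ (length-filter-map P? (f zero ,_) ys)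
                 (length-filter-cartesianProduct P? (f ∘ suc) ys) ⟩
  ∑[ i < suc n ] length (filter (λ y → P? (f i , y)) ys) ∎
  where open ≡-Reasoning

count : {P : Pred (Fin n) p} → Decidable P → ℕ
count {n = n} P? = ∑[ i < n ] indicator (P? i)

length-filter-allFin : {P : Pred (Fin n) p} (P? : Decidable P) →
                       length (filter P? (allFin n)) ≡ count P?
length-filter-allFin P? = length-filter-tabulate P? (λ i → i)

length-filter-allPairs : {P : Pred (Fin n × Fin n) p} (P? : Decidable P) →
                         length (filter P? (cartesianProduct (allFin n) (allFin n))) ≡
                         ∑[ i < n ] count (λ j → P? (i , j))
length-filter-allPairs {n = n} P? =
  trans (length-filter-cartesianProduct P? (λ i → i) (allFin n))
        (sum-cong-≗ (λ i → length-filter-allFin (λ j → P? (i , j))))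

module _ {P : Pred (Fin n) p} (P? : Decidable P) where

  count-∅ : (∀ i → ¬ P i) → count P? ≡ 0
  count-∅ P=∅ = trans (sum-cong-≗ (λ i → indicator-no (P=∅ i) (P? i))) (sum-replicate-zero n)

  count-cong : {Q : Pred (Fin n) q} (Q? : Decidable Q) → P ≐′ Q → count P? ≡ count Q?
  count-cong Q? (P⊆Q , Q⊆P) = sum-cong-≗ (λ i → indicator-⇔ (P⊆Q i) (Q⊆P i) (P? i) (Q? i))

  count-∪ : {Q : Pred (Fin n) q} (Q? : Decidable Q) → P ⊥′ Q →
            count (P? ∪? Q?) ≡ count P? + count Q?
  count-∪ Q? P⊥Q = trans (sum-cong-≗ (λ i → indicator-⊎ (P⊥Q i) (P? i) (Q? i)))
                         (∑-distrib-+ (indicator ∘ P?) (indicator ∘ Q?))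

count-partition : {P : Pred (Fin n) p} {Q : Pred (Fin n) q} {R : Pred (Fin n) r}
                  (P? : Decidable P) (Q? : Decidable Q) (R? : Decidable R) →
                  P ≐′ Q ∪ R → Q ⊥′ R → count P? ≡ count Q? + count R?
count-partition P? Q? R? P≐Q∪R Q⊥R = trans (count-cong P? (Q? ∪? R?) P≐Q∪R) (count-∪ Q? R? Q⊥R)

count-｛｝ : (a : Fin n) → count (a ≟_) ≡ 1
count-｛｝ {n = suc n} zero    = cong suc (sum-replicate-zero n)
count-｛｝ {n = suc n} (suc a) = count-｛｝ a

count-∩｛｝ : {P : Pred (Fin n) p} (P? : Decidable P) (a : Fin n) →
             count (P? ∩? (a ≟_)) ≡ indicator (P? a)
count-∩｛｝ P? a with P? a
... | yes Pa = trans (count-cong (P? ∩? (a ≟_)) (a ≟_) ((λ _ → proj₂) , λ { _ refl → Pa , refl }))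
                     (count-｛｝ a)
... | no ¬Pa = count-∅ (P? ∩? (a ≟_)) λ { _ (Pa , refl) → ¬Pa Pa }

count-remove : {P : Pred (Fin n) p} (P? : Decidable P) {a : Fin n} → P a →
               count P? ≡ suc (count (P? ∩? ∁? (a ≟_)))
count-remove {P = P} P? {a} Pa = trans
  (count-partition P? (a ≟_) (P? ∩? ∁? (a ≟_)) (split , join) (λ { _ (refl , _ , a≢a) → a≢a refl }))
  (cong (_+ count (P? ∩? ∁? (a ≟_))) (count-｛｝ a))
  where
  split : ∀ i → P i → a ≡ i ⊎ (P i × a ≢ i)
  split i Pi with a ≟ i
  ... | yes a≡i = inj₁ a≡i
  ... | no  a≢i = inj₂ (Pi , a≢i)
  join : ∀ i → a ≡ i ⊎ (P i × a ≢ i) → P i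
  join i (inj₁ refl)     = Pa
  join i (inj₂ (Pi , _)) = Pi

count≡0⇒∅ : {P : Pred (Fin n) p} (P? : Decidable P) → count P? ≡ 0 → ∀ i → ¬ P i
count≡0⇒∅ P? count≡0 i Pi = 0≢1+n (trans (sym count≡0) (count-remove P? Pi))

count≢0⇒∃ : {P : Pred (Fin n) p} (P? : Decidable P) → count P? ≢ 0 → ∃ P
count≢0⇒∃ P? count≢0 with any? P?
... | yes ∃P = ∃P
... | no ¬∃P = contradiction (count-∅ P? (λ i Pi → ¬∃P (i , Pi))) count≢0

∃!-unique : {P : Pred A p} → ∃! _≡_ P → ∀ {x y} → P x → P y → x ≡ y
∃!-unique (_ , _ , unique) Px Py = trans (sym (unique Px)) (unique Py)

count≡1⇒∃! : {P : Pred (Fin n) p} (P? : Decidable P) → count P? ≡ 1 → ∃! _≡_ P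
count≡1⇒∃! {P = P} P? count≡1 with count≢0⇒∃ P? (λ count≡0 → 0≢1+n (trans (sym count≡0) count≡1))
... | a , Pa = a , Pa , λ {i} Pi → unique i Pi
  where
  rest≡0 : count (P? ∩? ∁? (a ≟_)) ≡ 0
  rest≡0 = suc-injective (trans (sym (count-remove P? Pa)) count≡1)
  unique : ∀ i → P i → a ≡ i
  unique i Pi with a ≟ i
  ... | yes a≡i = a≡i
  ... | no  a≢i = contradiction (Pi , a≢i) (count≡0⇒∅ (P? ∩? ∁? (a ≟_)) rest≡0 i)

module Neighbourhoods (G : Graph n) where

  infix 4 _~_ _~?_

  _~_ : Fin n → Fin n → Set
  _~_ = Adjacent G

  _~?_ : ∀ u v → Dec (u ~ v)
  _~?_ = adjacent? G

  ~-sym : ∀ {u v} → u ~ v → v ~ u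
  ~-sym {u} {v} = subst T (Graph.sym G u v)

  ~⇒≢ : ∀ {u v} → u ~ v → u ≢ v
  ~⇒≢ {u} u~u refl = subst T (irrefl G u) u~u

  CommonNeighbour : Fin n → Fin n → Pred (Fin n) _
  CommonNeighbour u v = (u ~_) ∩ (v ~_)

  commonNeighbour? : ∀ u v → Decidable (CommonNeighbour u v)
  commonNeighbour? u v = (u ~?_) ∩? (v ~?_)

module StronglyRegular {k : ℕ} (G : Graph n) (srg : IsSRG G k 1 2) where

  open Neighbourhoods G
  open ≡-Reasoning

  count-neighbours : ∀ v → count (v ~?_) ≡ k
  count-neighbours v = trans (sym (length-filter-allFin (v ~?_))) (proj₁ srg v)

  count-commonNeighbours-adjacent : ∀ {u v} → u ~ v → count (commonNeighbour? u v) ≡ 1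
  count-commonNeighbours-adjacent {u} {v} u~v =
    trans (sym (length-filter-allFin (commonNeighbour? u v))) (proj₁ (proj₂ srg) u v u~v)

  count-commonNeighbours-nonadjacent : ∀ {u v} → u ≢ v → ¬ u ~ v → count (commonNeighbour? u v) ≡ 2
  count-commonNeighbours-nonadjacent {u} {v} u≢v u≁v =
    trans (sym (length-filter-allFin (commonNeighbour? u v))) (proj₂ (proj₂ srg) u v u≢v u≁v)

  adjacent⇒∃!commonNeighbour : ∀ {u v} → u ~ v → ∃! _≡_ (CommonNeighbour u v)
  adjacent⇒∃!commonNeighbour {u} {v} u~v =
    count≡1⇒∃! (commonNeighbour? u v) (count-commonNeighbours-adjacent u~v)

  nonadjacent⇒∃!otherCommonNeighbour : ∀ {u v x} → u ≢ v → ¬ u ~ v → CommonNeighbour u v x →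
                                       ∃! _≡_ (CommonNeighbour u v ∩ ∁ ｛ x ｝)
  nonadjacent⇒∃!otherCommonNeighbour {u} {v} {x} u≢v u≁v x∈N =
    count≡1⇒∃! (commonNeighbour? u v ∩? ∁? (x ≟_)) (suc-injective (begin
      suc (count (commonNeighbour? u v ∩? ∁? (x ≟_))) ≡⟨ count-remove (commonNeighbour? u v) x∈N ⟨
      count (commonNeighbour? u v)                    ≡⟨ count-commonNeighbours-nonadjacent u≢v u≁v ⟩
      2                                               ∎))

  commonNeighbour-unique : ∀ {u v x y} → u ~ v →
                           CommonNeighbour u v x → CommonNeighbour u v y → x ≡ y
  commonNeighbour-unique u~v = ∃!-unique (adjacent⇒∃!commonNeighbour u~v)

  otherCommonNeighbour-unique : ∀ {u v x y z} → u ≢ v → ¬ u ~ v → CommonNeighbour u v x →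
                                (CommonNeighbour u v ∩ ∁ ｛ x ｝) y →
                                (CommonNeighbour u v ∩ ∁ ｛ x ｝) z → y ≡ z
  otherCommonNeighbour-unique u≢v u≁v x∈N =
    ∃!-unique (nonadjacent⇒∃!otherCommonNeighbour u≢v u≁v x∈N)

module PentagonsThroughPath
  {k : ℕ} (G : Graph n) (srg : IsSRG G k 1 2) {v₁ v₀ v₂ : Fin n}
  (v₀~v₁ : Adjacent G v₀ v₁) (v₀~v₂ : Adjacent G v₀ v₂)
  (v₁≢v₂ : v₁ ≢ v₂) (v₁≁v₂ : ¬ Adjacent G v₁ v₂)
  {a : Fin n} (v₀~a : Adjacent G v₀ a) (v₁~a : Adjacent G v₁ a)
  {w : Fin n} (v₁~w : Adjacent G v₁ w) (v₂~w : Adjacent G v₂ w) (v₀≢w : v₀ ≢ w)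
  where

  open Neighbourhoods G
  open StronglyRegular G srg
  open ≡-Reasoning

  no-common-neighbour : ∀ {u} → v₀ ~ u → v₁ ~ u → ¬ v₂ ~ u
  no-common-neighbour v₀~u v₁~u v₂~u =
    v₁≢v₂ (commonNeighbour-unique v₀~u (v₀~v₁ , ~-sym v₁~u) (v₀~v₂ , ~-sym v₂~u))

  v₀≁w : ¬ v₀ ~ w
  v₀≁w v₀~w = no-common-neighbour v₀~w v₁~w v₂~w

  commonNeighbour-v₁v₂ : ∀ {y} → v₁ ~ y → v₂ ~ y → v₀ ≡ y ⊎ w ≡ y
  commonNeighbour-v₁v₂ {y} v₁~y v₂~y with v₀ ≟ y
  ... | yes v₀≡y = inj₁ v₀≡y
  ... | no  v₀≢y = inj₂ (otherCommonNeighbour-unique v₁≢v₂ v₁≁v₂ (~-sym v₀~v₁ , ~-sym v₀~v₂)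
                           ((v₁~w , v₂~w) , v₀≢w) ((v₁~y , v₂~y) , v₀≢y))

  Extension : Pred (Fin n) _
  Extension x = v₂ ~ x × ¬ v₀ ~ x × ¬ v₁ ~ x

  extension? : Decidable Extension
  extension? x = v₂ ~? x ×-dec ¬? (v₀ ~? x) ×-dec ¬? (v₁ ~? x)

  extension-adjacent? : ∀ u → Decidable (Extension ∩ (_~ u))
  extension-adjacent? u = extension? ∩? (_~? u)

  v₁≢extension : ∀ {x} → Extension x → v₁ ≢ x
  v₁≢extension (_ , v₀≁x , _) v₁≡x = v₀≁x (subst (v₀ ~_) v₁≡x v₀~v₁)

  pentagon⇒extension : ∀ {x y} → InducedPentagon G v₁ v₀ v₂ x y → Extension x
  pentagon⇒extension (_ , (_ , _ , v₂~x , _ , _) , (_ , v₁≁x , v₀≁x , _ , _)) = v₂~x , v₀≁x , v₁≁x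

  closes-pentagon : ∀ {x y} → Extension x → v₁ ~ y → x ~ y → a ≢ y → w ≢ y →
                    InducedPentagon G v₁ v₀ v₂ x y
  closes-pentagon {x} {y} ext@(v₂~x , v₀≁x , v₁≁x) v₁~y x~y a≢y w≢y =
      ( ~⇒≢ (~-sym v₀~v₁) , v₁≢v₂ , v₁≢extension ext , ~⇒≢ v₁~y , ~⇒≢ v₀~v₂
      , v₀≢x , v₀≢y , ~⇒≢ v₂~x , v₂≢y , ~⇒≢ x~y )
    , (~-sym v₀~v₁ , v₀~v₂ , v₂~x , x~y , ~-sym v₁~y)
    , (v₁≁v₂ , v₁≁x , v₀≁x , v₀≁y , v₂≁y)
    where
    v₀≢x : v₀ ≢ x
    v₀≢x v₀≡x = v₁≁x (subst (v₁ ~_) v₀≡x (~-sym v₀~v₁))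
    v₀≢y : v₀ ≢ y
    v₀≢y v₀≡y = v₀≁x (subst (_~ x) (sym v₀≡y) (~-sym x~y))
    v₂≢y : v₂ ≢ y
    v₂≢y v₂≡y = v₁≁v₂ (subst (v₁ ~_) (sym v₂≡y) v₁~y)
    v₀≁y : ¬ v₀ ~ y
    v₀≁y v₀~y = a≢y (commonNeighbour-unique v₀~v₁ (v₀~a , v₁~a) (v₀~y , v₁~y))
    v₂≁y : ¬ v₂ ~ y
    v₂≁y v₂~y = [ v₀≢y , w≢y ] (commonNeighbour-v₁v₂ v₁~y v₂~y)

  k≡extensions+3 : k ≡ count extension? + 3
  k≡extensions+3 = begin
    k
      ≡⟨ count-neighbours v₂ ⟨
    count (v₂ ~?_)
      ≡⟨ count-partition (v₂ ~?_) extension? (cn₀₂? ∪? cn₁₂?) (split , join) disjoint ⟩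
    count extension? + count (cn₀₂? ∪? cn₁₂?)
      ≡⟨ cong (count extension? +_) (count-∪ cn₀₂? cn₁₂? cn₀₂⊥cn₁₂) ⟩
    count extension? + (count cn₀₂? + count cn₁₂?)
      ≡⟨ cong (count extension? +_) (cong₂ _+_ (count-commonNeighbours-adjacent v₀~v₂)
                                              (count-commonNeighbours-nonadjacent v₁≢v₂ v₁≁v₂)) ⟩
    count extension? + 3 ∎
    where
    cn₀₂? : Decidable (CommonNeighbour v₀ v₂)
    cn₀₂? = commonNeighbour? v₀ v₂
    cn₁₂? : Decidable (CommonNeighbour v₁ v₂)
    cn₁₂? = commonNeighbour? v₁ v₂
    split : ∀ x → v₂ ~ x → (Extension ∪ CommonNeighbour v₀ v₂ ∪ CommonNeighbour v₁ v₂) x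
    split x v₂~x with v₀ ~? x | v₁ ~? x
    ... | yes v₀~x | _        = inj₂ (inj₁ (v₀~x , v₂~x))
    ... | no  _    | yes v₁~x = inj₂ (inj₂ (v₁~x , v₂~x))
    ... | no  v₀≁x | no  v₁≁x = inj₁ (v₂~x , v₀≁x , v₁≁x)
    join : ∀ x → (Extension ∪ CommonNeighbour v₀ v₂ ∪ CommonNeighbour v₁ v₂) x → v₂ ~ x
    join x (inj₁ (v₂~x , _))        = v₂~x
    join x (inj₂ (inj₁ (_ , v₂~x))) = v₂~x
    join x (inj₂ (inj₂ (_ , v₂~x))) = v₂~x
    disjoint : Extension ⊥′ (CommonNeighbour v₀ v₂ ∪ CommonNeighbour v₁ v₂)
    disjoint x ((_ , v₀≁x , _) , inj₁ (v₀~x , _)) = v₀≁x v₀~x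
    disjoint x ((_ , _ , v₁≁x) , inj₂ (v₁~x , _)) = v₁≁x v₁~x
    cn₀₂⊥cn₁₂ : CommonNeighbour v₀ v₂ ⊥′ CommonNeighbour v₁ v₂
    cn₀₂⊥cn₁₂ x ((v₀~x , v₂~x) , (v₁~x , _)) = no-common-neighbour v₀~x v₁~x v₂~x

  pentagonsExtending : Fin n → ℕ
  pentagonsExtending x = count (inducedPentagon? G v₁ v₀ v₂ x)

  commonNeighbours-of-extension : ∀ {x} → Extension x →
                                  pentagonsExtending x + (indicator (x ~? a) + indicator (x ~? w)) ≡ 2
  commonNeighbours-of-extension {x} ext@(_ , _ , v₁≁x) = begin
    pentagonsExtending x + (indicator (x ~? a) + indicator (x ~? w))
      ≡⟨ cong (pentagonsExtending x +_) (cong₂ _+_ (count-∩｛｝ (x ~?_) a) (count-∩｛｝ (x ~?_) w)) ⟨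
    pentagonsExtending x + (count x~a? + count x~w?)
      ≡⟨ cong (pentagonsExtending x +_) (count-∪ x~a? x~w? a-w-disjoint) ⟨
    pentagonsExtending x + count (x~a? ∪? x~w?)
      ≡⟨ count-partition (commonNeighbour? v₁ x) (inducedPentagon? G v₁ v₀ v₂ x) (x~a? ∪? x~w?)
                         (split , join) disjoint ⟨
    count (commonNeighbour? v₁ x)
      ≡⟨ count-commonNeighbours-nonadjacent (v₁≢extension ext) v₁≁x ⟩
    2 ∎
    where
    x~a? : Decidable ((x ~_) ∩ ｛ a ｝)
    x~a? = (x ~?_) ∩? (a ≟_)
    x~w? : Decidable ((x ~_) ∩ ｛ w ｝)
    x~w? = (x ~?_) ∩? (w ≟_)
    Closing : Pred (Fin n) _
    Closing = InducedPentagon G v₁ v₀ v₂ x ∪ (x ~_) ∩ ｛ a ｝ ∪ (x ~_) ∩ ｛ w ｝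
    split : ∀ y → CommonNeighbour v₁ x y → Closing y
    split y (v₁~y , x~y) with a ≟ y | w ≟ y
    ... | yes a≡y | _       = inj₂ (inj₁ (x~y , a≡y))
    ... | no  _   | yes w≡y = inj₂ (inj₂ (x~y , w≡y))
    ... | no  a≢y | no  w≢y = inj₁ (closes-pentagon ext v₁~y x~y a≢y w≢y)
    join : ∀ y → Closing y → CommonNeighbour v₁ x y
    join y (inj₁ (_ , (_ , _ , _ , x~y , y~v₁) , _)) = ~-sym y~v₁ , x~y
    join y (inj₂ (inj₁ (x~a , refl)))             = v₁~a , x~a
    join y (inj₂ (inj₂ (x~w , refl)))             = v₁~w , x~w
    disjoint : InducedPentagon G v₁ v₀ v₂ x ⊥′ ((x ~_) ∩ ｛ a ｝ ∪ (x ~_) ∩ ｛ w ｝)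
    disjoint y ((_ , _ , (_ , _ , _ , v₀≁y , _)) , inj₁ (_ , refl)) = v₀≁y v₀~a
    disjoint y ((_ , _ , (_ , _ , _ , _ , v₂≁y)) , inj₂ (_ , refl)) = v₂≁y v₂~w
    a-w-disjoint : ((x ~_) ∩ ｛ a ｝) ⊥′ ((x ~_) ∩ ｛ w ｝)
    a-w-disjoint y ((_ , refl) , (_ , w≡a)) = v₀≁w (subst (v₀ ~_) (sym w≡a) v₀~a)

  count-extensions-adjacent-to-a : count (extension-adjacent? a) ≡ 1
  count-extensions-adjacent-to-a = suc-injective (begin
    1 + count (extension-adjacent? a)
      ≡⟨ cong (_+ count (extension-adjacent? a)) (count-｛｝ v₀) ⟨
    count (v₀ ≟_) + count (extension-adjacent? a)
      ≡⟨ count-partition (commonNeighbour? a v₂) (v₀ ≟_) (extension-adjacent? a)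
                         (split , join) disjoint ⟨
    count (commonNeighbour? a v₂)
      ≡⟨ count-commonNeighbours-nonadjacent a≢v₂ a≁v₂ ⟩
    2 ∎)
    where
    a≢v₂ : a ≢ v₂
    a≢v₂ a≡v₂ = v₁≁v₂ (subst (v₁ ~_) a≡v₂ v₁~a)
    a≁v₂ : ¬ a ~ v₂
    a≁v₂ a~v₂ = no-common-neighbour v₀~a v₁~a (~-sym a~v₂)
    split : ∀ x → CommonNeighbour a v₂ x → (｛ v₀ ｝ ∪ Extension ∩ (_~ a)) x
    split x (a~x , v₂~x) with v₀ ≟ x
    ... | yes v₀≡x = inj₁ v₀≡x
    ... | no  v₀≢x = inj₂ ((v₂~x , v₀≁x , v₁≁x) , ~-sym a~x)
      where
      v₀≁x : ¬ v₀ ~ x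
      v₀≁x v₀~x = v₁≁v₂ (subst (_~ v₂)
                               (commonNeighbour-unique v₀~a (v₀~x , a~x) (v₀~v₁ , ~-sym v₁~a))
                               (~-sym v₂~x))
      v₁≁x : ¬ v₁ ~ x
      v₁≁x v₁~x = v₀≢x (commonNeighbour-unique v₁~a (~-sym v₀~v₁ , ~-sym v₀~a) (v₁~x , a~x))
    join : ∀ x → (｛ v₀ ｝ ∪ Extension ∩ (_~ a)) x → CommonNeighbour a v₂ x
    join x (inj₁ refl)                = ~-sym v₀~a , ~-sym v₀~v₂
    join x (inj₂ ((v₂~x , _) , x~a)) = ~-sym x~a , v₂~x
    disjoint : ｛ v₀ ｝ ⊥′ Extension ∩ (_~ a)
    disjoint x (refl , (_ , _ , v₁≁v₀) , _) = v₁≁v₀ (~-sym v₀~v₁)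

  count-extensions-adjacent-to-w : count (extension-adjacent? w) ≡ 1
  count-extensions-adjacent-to-w = begin
    count (extension-adjacent? w)
      ≡⟨ count-cong (commonNeighbour? w v₂) (extension-adjacent? w) (unfold , fold) ⟨
    count (commonNeighbour? w v₂)
      ≡⟨ count-commonNeighbours-adjacent (~-sym v₂~w) ⟩
    1 ∎
    where
    unfold : ∀ x → CommonNeighbour w v₂ x → (Extension ∩ (_~ w)) x
    unfold x (w~x , v₂~x) = (v₂~x , v₀≁x , v₁≁x) , ~-sym w~x
      where
      v₀≁x : ¬ v₀ ~ x
      v₀≁x v₀~x =
        v₀≢w (commonNeighbour-unique (~-sym v₂~x) (~-sym v₀~x , ~-sym v₀~v₂) (~-sym w~x , v₂~w))
      v₁≁x : ¬ v₁ ~ x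
      v₁≁x v₁~x =
        v₁≢v₂ (commonNeighbour-unique (~-sym w~x) (~-sym v₁~x , ~-sym v₁~w) (~-sym v₂~x , ~-sym v₂~w))
    fold : ∀ x → (Extension ∩ (_~ w)) x → CommonNeighbour w v₂ x
    fold x ((v₂~x , _) , x~w) = ~-sym x~w , v₂~x

  -- The decision is an argument so that matching on it also evaluates the indicators built from it.
  pentagonsExtending-balance :
    ∀ x (ext? : Dec (Extension x)) →
    pentagonsExtending x + (indicator (ext? ×-dec x ~? a) + indicator (ext? ×-dec x ~? w))
    ≡ indicator ext? + indicator ext?
  pentagonsExtending-balance x (yes ext)  = commonNeighbours-of-extension ext
  pentagonsExtending-balance x (no  ¬ext) =
    cong (_+ 0) (count-∅ (inducedPentagon? G v₁ v₀ v₂ x) (λ y → ¬ext ∘ pentagon⇒extension))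

  pentagons+2≡2·extensions : pentagonsThrough G v₁ v₀ v₂ + 2 ≡ count extension? + count extension?
  pentagons+2≡2·extensions = begin
    pentagonsThrough G v₁ v₀ v₂ + 2
      ≡⟨ cong₂ _+_ (length-filter-allPairs (λ p → inducedPentagon? G v₁ v₀ v₂ (proj₁ p) (proj₂ p)))
                   (sym (cong₂ _+_ count-extensions-adjacent-to-a count-extensions-adjacent-to-w)) ⟩
    ∑[ x < n ] pentagonsExtending x + (count (extension-adjacent? a) + count (extension-adjacent? w))
      ≡⟨ cong (∑[ x < n ] pentagonsExtending x +_) (∑-distrib-+ [x~a] [x~w]) ⟨
    ∑[ x < n ] pentagonsExtending x + ∑[ x < n ] ([x~a] x + [x~w] x)
      ≡⟨ ∑-distrib-+ pentagonsExtending (λ x → [x~a] x + [x~w] x) ⟨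
    ∑[ x < n ] (pentagonsExtending x + ([x~a] x + [x~w] x))
      ≡⟨ sum-cong-≗ (λ x → pentagonsExtending-balance x (extension? x)) ⟩
    ∑[ x < n ] (indicator (extension? x) + indicator (extension? x))
      ≡⟨ ∑-distrib-+ (indicator ∘ extension?) (indicator ∘ extension?) ⟩
    count extension? + count extension? ∎
    where
    [x~a] [x~w] : Fin n → ℕ
    [x~a] = indicator ∘ extension-adjacent? a
    [x~w] = indicator ∘ extension-adjacent? w

open import Data.Integer using (+_; _*_; _-_)
import Data.Integer as ℤ
open import Data.Integer.Properties using (pos-+)
open import Data.Integer.Tactic.RingSolver using (solve-∀)

p+2≡e+e∧k≡e+3⇒p≡2[k-4] : ∀ {p e k} → p + 2 ≡ e + e → k ≡ e + 3 → + p ≡ + 2 * (+ k - + 4)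
p+2≡e+e∧k≡e+3⇒p≡2[k-4] {p} {e} p+2≡e+e refl = begin
  + p                         ≡⟨ cancel (+ p) ⟩
  + p ℤ.+ + 2 - + 2           ≡⟨ cong (_- + 2) (pos-+ p 2) ⟨
  + (p + 2) - + 2             ≡⟨ cong (λ m → + m - + 2) p+2≡e+e ⟩
  + (e + e) - + 2             ≡⟨ cong (_- + 2) (pos-+ e e) ⟩
  + e ℤ.+ + e - + 2           ≡⟨ regroup (+ e) ⟩
  + 2 * (+ e ℤ.+ + 3 - + 4)   ≡⟨ cong (λ i → + 2 * (i - + 4)) (pos-+ e 3) ⟨
  + 2 * (+ (e + 3) - + 4)     ∎
  where
  open ≡-Reasoning
  cancel : ∀ i → i ≡ i ℤ.+ + 2 - + 2
  cancel = solve-∀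
  regroup : ∀ i → i ℤ.+ i - + 2 ≡ + 2 * (i ℤ.+ + 3 - + 4)
  regroup = solve-∀

proposition2 : (n k : ℕ) (G : Graph n) → IsSRG G k 1 2 →
               (v₁ v₀ v₂ : Fin n) →
               Adjacent G v₀ v₁ → Adjacent G v₀ v₂ → ¬ (v₁ ≡ v₂) → ¬ Adjacent G v₁ v₂ →
               + pentagonsThrough G v₁ v₀ v₂ ≡ + 2 * (+ k - + 4)
proposition2 n k G srg v₁ v₀ v₂ v₀~v₁ v₀~v₂ v₁≢v₂ v₁≁v₂ =
  let open Neighbourhoods G
      open StronglyRegular G srg
      a , (v₀~a , v₁~a) , _ = adjacent⇒∃!commonNeighbour v₀~v₁
      w , ((v₁~w , v₂~w) , v₀≢w) , _ =
        nonadjacent⇒∃!otherCommonNeighbour v₁≢v₂ v₁≁v₂ (~-sym v₀~v₁ , ~-sym v₀~v₂)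
      open PentagonsThroughPath G srg v₀~v₁ v₀~v₂ v₁≢v₂ v₁≁v₂ v₀~a v₁~a v₁~w v₂~w v₀≢w
  in p+2≡e+e∧k≡e+3⇒p≡2[k-4] pentagons+2≡2·extensions k≡extensions+3
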